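{- Let $\mathcal S$ be one of the seven Weyl models, with group $G$ of order $2d$, and let $\omega=\phi\psi\phi\cdots$ ($d$ alternating generators) be the unique element of length $d$ in $G$. For every starting point $(a,b)\in\mathcal C$, \[ \sum_{g\in G\setminus\{\omega\}}\varepsilon_g\,P^{a,b}_g(x,y)=\begin{cases}0&\text{if }(a,b)\notin\bigcup_{g\in G}\mathcal Q_g,\\ \varepsilon_h\,Q^{\dot h(a,b)}(x,y)&\text{if }\dot h(a,b)\in\mathcal Q\text{ for }h\in G.\end{cases} \]
   Context: Weyl models (step sets): simple $\{(1,0),(0,1),(-1,0),(0,-1)\}$; diagonal $\{(1,1),(-1,1),(-1,-1),(1,-1)\}$; king $\{ -1,0,1\}^2\setminus\{(0,0)\}$; diabolo $\{(1,0),(1,1),(-1,1),(-1,0),(-1,-1),(1,-1)\}$; tandem $\{(1,0),(-1,1),(0,-1)\}$; double tandem $\{(1,0),(-1,1),(0,-1),(-1,0),(1,-1),(0,1)\}$; Gouyou-Beauchamps $\{(1,0),(-1,0),(-1,1),(1,-1)\}$. Write $\sum_{(i,j)\in\mathcal S}x^iy^j=\bar yH_-(x)+H_0(x)+yH_+(x)=\bar xV_-(y)+V_0(y)+xV_+(y)$ with $\bar x=1/x$, $\bar y=1/y$. The group $G$ is generated by the involutions $\phi(u,v)=(\bar uV_-(v)/V_+(v),v)$ and $\psi(u,v)=(u,\bar vH_-(u)/H_+(u))$; it is finite of order $2d$, $d\in\{2,3,4\}$, and each $g(x,y)$ is a pair of Laurent monomials. $\ell(g)$ is the least number of generators in a product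 equal to $g$, and $\varepsilon_g=(-1)^{\ell(g)}$. $G$ acts on rational functions by $g(F(x,y))=F(g(x,y))$, and on points by $\dot g(a,b)=(c,d')$ where $x^cy^{d'}=\bar x\bar y\,g(x^{a+1}y^{b+1})$. $\mathcal Q=\{(i,j):i,j\ge0\}$, $\mathcal Q_g=\dot g(\mathcal Q)$, $\mathcal C=\{(i,j)\in\mathbb Z^2:i\ge0\text{ or }j\ge0\}$. A walk is confined to $\mathcal C$ if all its vertices lie in $\mathcal C$ and it uses no step between $(-1,0)$ and $(0,-1)$. $C^{a,b}_{k,l}$ is the length generating function (variable $t$) of walks from $(a,b)$ to $(k,l)$ confined to $\mathcal C$ (zero if $(k,l)\notin\mathcal C$); $Q^{a,b}_{i,j}$ that of walks from $(a,b)$ to $(i,j)$ with all vertices in $\mathcal Q$, and $Q^{a,b}(x,y)=\sum_{(i,j)\in\mathcal Q}Q^{a,b}_{i,j}x^iy^j$. For $g\in G$, $P^{a,b}_g(x,y)=\sum_{(i,j)\in\mathcal Q}C^{a,b}_{\dot g(i,j)}x^iy^j\in\mathbb Q[x,y][[t]]$. -}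

module Defs where

open import Data.Bool using (Bool; true; false; _∧_; _∨_; not; if_then_else_; T)
open import Data.Nat as ℕ using (ℕ; zero; suc)
open import Data.Integer as ℤ using (ℤ; +_; -_; _+_; _-_; _*_; 0ℤ; 1ℤ; -1ℤ)
open import Data.Product using (_×_; _,_; proj₁; proj₂)
open import Data.Sum using (_⊎_)
open import Data.List as List using (List; []; _∷_; _++_; map; concatMap; filter; length; foldr)
open import Data.Bool.Properties using (T?)
open import Data.Unit using (tt)
open import Relation.Nullary.Decidable using (⌊_⌋)
open import Relation.Binary.PropositionalEquality using (_≡_; refl)

Point : Set
Point = ℤ × ℤ

all : {A : Set} → (A → Bool) → List A → Bool
all f [] = true
all f (x ∷ xs) = f x ∧ all f xs

any : {A : Set} → (A → Bool) → List A → Bool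
any f [] = false
any f (x ∷ xs) = f x ∨ any f xs

_==ℤ_ : ℤ → ℤ → Bool
x ==ℤ y = ⌊ x ℤ.≟ y ⌋

_==P_ : Point → Point → Bool
(a , b) ==P (c , d) = (a ==ℤ c) ∧ (b ==ℤ d)

_≤ℤ_ : ℤ → ℤ → Bool
x ≤ℤ y = ⌊ x ℤ.≤? y ⌋

_+P_ : Point → Point → Point
(a , b) +P (c , d) = (a + c , b + d)

data Model : Set where
  simple diagonal king diabolo tandem doubleTandem gouyouBeauchamps : Model

steps : Model → List Point
steps simple = (+ 1 , 0ℤ) ∷ (0ℤ , + 1) ∷ (-1ℤ , 0ℤ) ∷ (0ℤ , -1ℤ) ∷ []
steps diagonal = (+ 1 , + 1) ∷ (-1ℤ , + 1) ∷ (-1ℤ , -1ℤ) ∷ (+ 1 , -1ℤ) ∷ []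
steps king = (+ 1 , 0ℤ) ∷ (+ 1 , + 1) ∷ (0ℤ , + 1) ∷ (-1ℤ , + 1)
           ∷ (-1ℤ , 0ℤ) ∷ (-1ℤ , -1ℤ) ∷ (0ℤ , -1ℤ) ∷ (+ 1 , -1ℤ) ∷ []
steps diabolo = (+ 1 , 0ℤ) ∷ (+ 1 , + 1) ∷ (-1ℤ , + 1) ∷ (-1ℤ , 0ℤ)
              ∷ (-1ℤ , -1ℤ) ∷ (+ 1 , -1ℤ) ∷ []
steps tandem = (+ 1 , 0ℤ) ∷ (-1ℤ , + 1) ∷ (0ℤ , -1ℤ) ∷ []
steps doubleTandem = (+ 1 , 0ℤ) ∷ (-1ℤ , + 1) ∷ (0ℤ , -1ℤ)
                   ∷ (-1ℤ , 0ℤ) ∷ (+ 1 , -1ℤ) ∷ (0ℤ , + 1) ∷ []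
steps gouyouBeauchamps = (+ 1 , 0ℤ) ∷ (-1ℤ , 0ℤ) ∷ (-1ℤ , + 1) ∷ (+ 1 , -1ℤ) ∷ []

-- For every Weyl model, V₋(y)/V₊(y) = y^(rV m) and H₋(x)/H₊(x) = x^(rH m)
-- are monomials.

rV : Model → ℤ
rV tandem = + 1
rV doubleTandem = + 1
rV gouyouBeauchamps = + 1
rV _ = 0ℤ

rH : Model → ℤ
rH tandem = + 1
rH doubleTandem = + 1
rH gouyouBeauchamps = + 2
rH _ = 0ℤ

-- exponents (multiset) of the Laurent polynomials V₋, V₊ (in y) and H₋, H₊ (in x)
Vminus Vplus Hminus Hplus : Model → List ℤ
Vminus m = map proj₂ (filter (λ s → proj₁ s ℤ.≟ -1ℤ) (steps m))
Vplus  m = map proj₂ (filter (λ s → proj₁ s ℤ.≟ + 1) (steps m))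
Hminus m = map proj₁ (filter (λ s → proj₂ s ℤ.≟ -1ℤ) (steps m))
Hplus  m = map proj₁ (filter (λ s → proj₂ s ℤ.≟ + 1) (steps m))

-- equality of duplicate-free exponent lists as sets (plus equal length)
sameSet : List ℤ → List ℤ → Bool
sameSet xs ys = ⌊ length xs ℕ.≟ length ys ⌋
              ∧ all (λ x → any (λ y → x ==ℤ y) ys) xs
              ∧ all (λ y → any (λ x → x ==ℤ y) xs) ys

ratioV-correct : ∀ m → T (sameSet (Vminus m) (map (λ j → j + rV m) (Vplus m)))
ratioV-correct simple = tt
ratioV-correct diagonal = tt
ratioV-correct king = tt
ratioV-correct diabolo = tt
ratioV-correct tandem = tt
ratioV-correct doubleTandem = tt
ratioV-correct gouyouBeauchamps = tt

ratioH-correct : ∀ m → T (sameSet (Hminus m) (map (λ i → i + rH m) (Hplus m)))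
ratioH-correct simple = tt
ratioH-correct diagonal = tt
ratioH-correct king = tt
ratioH-correct diabolo = tt
ratioH-correct tandem = tt
ratioH-correct doubleTandem = tt
ratioH-correct gouyouBeauchamps = tt

d : Model → ℕ
d tandem = 3
d doubleTandem = 3
d gouyouBeauchamps = 4
d _ = 2

-- Group elements.  A group element g is a pair of Laurent monomials
-- g(x,y) = (x^p y^q , x^r y^s), stored as ((p , q) , (r , s)).

Mono : Set
Mono = ℤ × ℤ

MonoPair : Set
MonoPair = Mono × Mono

_·M_ : ℤ → Mono → Mono
k ·M (p , q) = (k * p , k * q)

_-M_ : Mono → Mono → Mono
(p , q) -M (r , s) = (p - r , q - s)

idPair : MonoPair
idPair = ((+ 1 , 0ℤ) , (0ℤ , + 1))

-- φ(u,v) = (ū V₋(v)/V₊(v), v) = (ū v^rV , v)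
φ-act : Model → MonoPair → MonoPair
φ-act m (u , v) = ((rV m ·M v) -M u , v)

-- ψ(u,v) = (u, v̄ H₋(u)/H₊(u)) = (u , v̄ u^rH)
ψ-act : Model → MonoPair → MonoPair
ψ-act m (u , v) = (u , (rH m ·M u) -M v)

data Gen : Set where
  φ ψ : Gen

other : Gen → Gen
other φ = ψ
other ψ = φ

act : Model → Gen → MonoPair → MonoPair
act m φ = φ-act m
act m ψ = ψ-act m

altWord : Model → Gen → ℕ → MonoPair → MonoPair
altWord m s zero w = w
altWord m s (suc k) w = act m s (altWord m (other s) k w)

-- Elements of G are named by alternating words: e (length 0), and
-- alt s k = s (other s) s ... (k letters, 1 ≤ k ≤ d).
data Elem : Set where
  e   : Elem
  alt : Gen → ℕ → Elem

value : Model → Elem → MonoPair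
value m e = idPair
value m (alt s k) = altWord m s k idPair

-- sanity check: the two alternating words of length d coincide (G is
-- dihedral of order 2d), so ω is well defined
ω-welldefined : ∀ m → value m (alt φ (d m)) ≡ value m (alt ψ (d m))
ω-welldefined simple = refl
ω-welldefined diagonal = refl
ω-welldefined king = refl
ω-welldefined diabolo = refl
ω-welldefined tandem = refl
ω-welldefined doubleTandem = refl
ω-welldefined gouyouBeauchamps = refl

ω : Model → Elem
ω m = alt φ (d m)

range1 : ℕ → List ℕ
range1 zero = []
range1 (suc n) = range1 n ++ (suc n ∷ [])

GminusΩ : Model → List Elem
GminusΩ m = e ∷ concatMap (λ k → alt φ k ∷ alt ψ k ∷ []) (range1 (d m ℕ.∸ 1))

G : Model → List Elem
G m = GminusΩ m ++ (ω m ∷ [])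

-- length ℓ(g) (alternating words of length ≤ d are reduced in a dihedral
-- group of order 2d)
ℓ : Elem → ℕ
ℓ e = 0
ℓ (alt s k) = k

ε : Elem → ℤ
ε g = (-1ℤ) ℤ.^ ℓ g

-- dotted action: x^c y^d' = x̄ ȳ g(x^(a+1) y^(b+1))
dotPair : MonoPair → Point → Point
dotPair ((p , q) , (r , s)) (a , b) =
  ( p * (a + 1ℤ) + r * (b + 1ℤ) - 1ℤ
  , q * (a + 1ℤ) + s * (b + 1ℤ) - 1ℤ )

dot : Model → Elem → Point → Point
dot m g = dotPair (value m g)

InQ : Point → Set
InQ (i , j) = 0ℤ ℤ.≤ i × 0ℤ ℤ.≤ j

InC : Point → Set
InC (i , j) = 0ℤ ℤ.≤ i ⊎ 0ℤ ℤ.≤ j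

inQ? : Point → Bool
inQ? (i , j) = (0ℤ ≤ℤ i) ∧ (0ℤ ≤ℤ j)

inC? : Point → Bool
inC? (i , j) = (0ℤ ≤ℤ i) ∨ (0ℤ ≤ℤ j)

-- Walks.  A walk of length n from p is a list of n steps of S; its
-- vertices are the partial sums starting at p.

words : Model → ℕ → List (List Point)
words m zero = [] ∷ []
words m (suc n) = concatMap (λ s → map (s ∷_) (words m n)) (steps m)

vertices : Point → List Point → List Point
vertices p [] = p ∷ []
vertices p (s ∷ w) = p ∷ vertices (p +P s) w

endpoint : Point → List Point → Point
endpoint p [] = p
endpoint p (s ∷ w) = endpoint (p +P s) w

forbidden : Point → Point → Bool
forbidden p q = ((p ==P (-1ℤ , 0ℤ)) ∧ (q ==P (0ℤ , -1ℤ)))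
              ∨ ((p ==P (0ℤ , -1ℤ)) ∧ (q ==P (-1ℤ , 0ℤ)))

noForbiddenStep : Point → List Point → Bool
noForbiddenStep p [] = true
noForbiddenStep p (s ∷ w) = not (forbidden p (p +P s)) ∧ noForbiddenStep (p +P s) w

confinedC : Point → List Point → Bool
confinedC p w = all inC? (vertices p w) ∧ noForbiddenStep p w

confinedQ : Point → List Point → Bool
confinedQ p w = all inQ? (vertices p w)

-- [t^n] C^{p}_{q} : number of length-n walks from p to q confined to 𝒞
Ccoeff : Model → ℕ → Point → Point → ℕ
Ccoeff m n p q = length (filter (λ w → T? (confinedC p w ∧ (endpoint p w ==P q))) (words m n))

-- [t^n] Q^{p}_{q} : number of length-n walks from p to q in 𝒬
Qcoeff : Model → ℕ → Point → Point → ℕ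
Qcoeff m n p q = length (filter (λ w → T? (confinedQ p w ∧ (endpoint p w ==P q))) (words m n))

-- [t^n x^i y^j] of  Σ_{g ∈ G∖{ω}} ε_g P^{a,b}_g(x,y)
-- where [x^i y^j] P^{a,b}_g = C^{a,b}_{ġ(i,j)}
sumLHS : Model → Point → ℕ → ℕ → ℕ → ℤ
sumLHS m p n i j =
  foldr (λ g acc → ε g * + Ccoeff m n p (dot m g (+ i , + j)) + acc) 0ℤ (GminusΩ m)

{-# OPTIONS --safe #-}
-- Both sides are compared with the signed orbit sum R_n(p, q) = Σ_{g ∈ G} ε_g [tⁿ] Q^{ġ p}_q.
-- For p ∈ 𝒞 and q ∈ 𝒬 the left-hand side equals R_n(p, q), by induction on n and the
-- first-step decomposition of walks.  For n = 0 this holds because g ↦ g⁻¹ preserves G ∖ {ω}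
-- and the signs, while ω̇ maps 𝒞 outside 𝒬.  In the inductive step, a step leaving 𝒞 or
-- crossing between (-1,0) and (0,-1) ends at a point whose orbit avoids 𝒬, so it contributes
-- to neither side; the linear part of each g permutes the steps; and the walks of R lost at
-- the boundary of 𝒬 start on the lines x = -1 or y = -1, which φ̇ and ψ̇ fix pointwise, so
-- they cancel because g ↦ φg and g ↦ ψg reverse signs.  Finally, the regions 𝒬_g are
-- pairwise disjoint, so at most one term of R survives.  The finitely many facts used about
-- each model are checked by evaluation, the geometric ones by Fourier–Motzkin elimination.

module Submission where

open import Defs
open import Data.Bool using (Bool; true; false; _∧_; _∨_; not; if_then_else_; T)
open import Data.Bool.Properties using (T?; T-≡; T-not-≡; T-∧; T-∨; ∧-zeroʳ; ⇔→≡)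
open import Data.Nat as ℕ using (ℕ; zero; suc; z≤n; s≤s)
import Data.Nat.Properties as ℕ
open import Data.Integer as ℤ using (ℤ; +_; -_; _+_; _-_; _*_; 0ℤ; 1ℤ; -1ℤ; -[1+_])
import Data.Integer.Properties as ℤ
open import Data.Integer.Tactic.RingSolver using (solve-∀)
open import Data.Product using (_×_; _,_; proj₁; proj₂; ∃; ∃₂)
open import Data.Product.Properties using (≡-dec)
open import Data.Sum using (_⊎_; inj₁; inj₂)
open import Data.List using (List; []; _∷_; _++_; map; concatMap; filter; length; foldr)
open import Data.List.Properties using (length-++; filter-++; length-filter)
open import Data.List.Membership.Propositional using (_∈_)
open import Data.List.Membership.Propositional.Properties using (∈-++⁻; ∈-filter⁻)
open import Data.List.Relation.Unary.All using (All; []; _∷_)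
import Data.List.Relation.Unary.All as All
import Data.List.Relation.Unary.All.Properties as All
open import Data.List.Relation.Unary.Any using (here; there)
open import Data.List.Relation.Unary.AllPairs using (_∷_)
open import Data.List.Relation.Unary.Unique.Propositional using (Unique)
open import Data.List.Relation.Unary.Unique.DecPropositional using (unique?)
open import Data.Empty using (⊥; ⊥-elim)
open import Function using (_∘_; _⇔_)
open import Function.Bundles using (Equivalence; mk⇔)
open import Relation.Nullary using (¬_; ¬?; yes; no)
open import Relation.Nullary.Decidable using (⌊_⌋; toWitness; fromWitness)
open import Relation.Binary.Definitions using (DecidableEquality)
open import Relation.Binary.PropositionalEquality using (_≡_; _≢_; ≢-sym; refl; sym; trans; cong; cong₂; subst)
open Relation.Binary.PropositionalEquality.≡-Reasoning

∑ : {A : Set} → List A → (A → ℤ) → ℤ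
∑ xs f = foldr (λ x acc → f x + acc) 0ℤ xs

infix 5 ∑
syntax ∑ xs (λ x → e) = ∑[ x ← xs ] e

module _ {A : Set} where

  ∑-cong : (xs : List A) {f g : A → ℤ} → (∀ {x} → x ∈ xs → f x ≡ g x) → ∑ xs f ≡ ∑ xs g
  ∑-cong []       f≡g = refl
  ∑-cong (x ∷ xs) f≡g = cong₂ _+_ (f≡g (here refl)) (∑-cong xs (f≡g ∘ there))

  ∑-zero : (xs : List A) {f : A → ℤ} → (∀ {x} → x ∈ xs → f x ≡ 0ℤ) → ∑ xs f ≡ 0ℤ
  ∑-zero []       f≡0 = refl
  ∑-zero (x ∷ xs) f≡0 = cong₂ _+_ (f≡0 (here refl)) (∑-zero xs (f≡0 ∘ there))

  ∑-++ : (xs ys : List A) (f : A → ℤ) → ∑ (xs ++ ys) f ≡ ∑ xs f + ∑ ys f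
  ∑-++ []       ys f = sym (ℤ.+-identityˡ _)
  ∑-++ (x ∷ xs) ys f = trans (cong (_+_ (f x)) (∑-++ xs ys f)) (sym (ℤ.+-assoc (f x) _ _))

  ∑-+ : (xs : List A) (f g : A → ℤ) → ∑[ x ← xs ] (f x + g x) ≡ ∑ xs f + ∑ xs g
  ∑-+ []       f g = refl
  ∑-+ (x ∷ xs) f g = trans (cong (_+_ (f x + g x)) (∑-+ xs f g)) (interchange (f x) (g x) _ _)
    where
    interchange : ∀ a b c d → (a + b) + (c + d) ≡ (a + c) + (b + d)
    interchange = solve-∀

  ∑-*ˡ : (c : ℤ) (xs : List A) (f : A → ℤ) → ∑[ x ← xs ] (c * f x) ≡ c * ∑ xs f
  ∑-*ˡ c []       f = sym (ℤ.*-zeroʳ c)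
  ∑-*ˡ c (x ∷ xs) f = trans (cong (_+_ (c * f x)) (∑-*ˡ c xs f)) (sym (ℤ.*-distribˡ-+ c (f x) _))

  ∑-neg : (xs : List A) (f : A → ℤ) → ∑[ x ← xs ] - f x ≡ - ∑ xs f
  ∑-neg []       f = refl
  ∑-neg (x ∷ xs) f = trans (cong (_+_ (- f x)) (∑-neg xs f)) (sym (ℤ.neg-distrib-+ (f x) _))

  ∑-if : (b : Bool) (xs : List A) (f : A → ℤ) →
         ∑[ x ← xs ] (if b then f x else 0ℤ) ≡ (if b then ∑ xs f else 0ℤ)
  ∑-if true  xs f = refl
  ∑-if false xs f = ∑-zero xs λ _ → refl

  ∑-unique : {xs : List A} {x : A} (f : A → ℤ) → Unique xs → x ∈ xs →
             (∀ {y} → y ∈ xs → y ≢ x → f y ≡ 0ℤ) → ∑ xs f ≡ f x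
  ∑-unique f (x≢ys ∷ _) (here refl) f≡0 =
    trans (cong (_+_ (f _)) (∑-zero _ λ y∈ys → f≡0 (there y∈ys) (≢-sym (All.lookup x≢ys y∈ys))))
          (ℤ.+-identityʳ _)
  ∑-unique {_ ∷ ys} f (y≢ys ∷ ys-unique) (there x∈ys) f≡0 =
    trans (cong (_+ ∑ ys f) (f≡0 (here refl) (λ y≡x → All.lookup y≢ys (subst (_∈ _) (sym y≡x) x∈ys) refl)))
          (trans (ℤ.+-identityˡ _) (∑-unique f ys-unique x∈ys (f≡0 ∘ there)))

module _ {A B : Set} where

  ∑-map : (h : A → B) (xs : List A) (f : B → ℤ) → ∑ (map h xs) f ≡ ∑ xs (f ∘ h)
  ∑-map h []       f = refl
  ∑-map h (x ∷ xs) f = cong (_+_ (f (h x))) (∑-map h xs f)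

  ∑-swap : (xs : List A) (ys : List B) (F : A → B → ℤ) →
           ∑[ x ← xs ] ∑[ y ← ys ] F x y ≡ ∑[ y ← ys ] ∑[ x ← xs ] F x y
  ∑-swap []       ys F = sym (∑-zero ys λ _ → refl)
  ∑-swap (x ∷ xs) ys F =
    trans (cong (_+_ (∑ ys (F x))) (∑-swap xs ys F)) (sym (∑-+ ys (F x) λ y → ∑[ x ← xs ] F x y))

count : {A : Set} → (A → Bool) → List A → ℕ
count P xs = length (filter (λ x → T? (P x)) xs)

indicator : Bool → ℤ
indicator b = if b then 1ℤ else 0ℤ

+-if : (b : Bool) (n : ℕ) → + (if b then n else 0) ≡ (if b then + n else 0ℤ)
+-if true  n = refl
+-if false n = refl

module _ {A : Set} where

  count-++ : (P : A → Bool) (xs ys : List A) → count P (xs ++ ys) ≡ count P xs ℕ.+ count P ys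
  count-++ P xs ys = trans (cong length (filter-++ (λ x → T? (P x)) xs ys)) (length-++ (filter (λ x → T? (P x)) xs))

  count-∧ˡ : (b : Bool) (P : A → Bool) (xs : List A) →
             count (λ x → b ∧ P x) xs ≡ (if b then count P xs else 0)
  count-∧ˡ true  P xs       = refl
  count-∧ˡ false P []       = refl
  count-∧ˡ false P (x ∷ xs) = count-∧ˡ false P xs

  count-cong : {P Q : A → Bool} (xs : List A) → (∀ x → P x ≡ Q x) → count P xs ≡ count Q xs
  count-cong []       P≡Q = refl
  count-cong {Q = Q} (x ∷ xs) P≡Q rewrite P≡Q x with Q x
  ... | true  = cong suc (count-cong xs P≡Q)
  ... | false = count-cong xs P≡Q

  count-none : (P : A → Bool) (xs : List A) → (∀ x → P x ≡ false) → count P xs ≡ 0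
  count-none P xs P≡false = trans (count-cong xs P≡false) (count-∧ˡ false (λ _ → true) xs)

module _ {A B : Set} where

  count-map : (P : B → Bool) (h : A → B) (xs : List A) → count P (map h xs) ≡ count (P ∘ h) xs
  count-map P h []       = refl
  count-map P h (x ∷ xs) with P (h x)
  ... | true  = cong suc (count-map P h xs)
  ... | false = count-map P h xs

  count-concatMap : (P : B → Bool) (F : A → List B) (xs : List A) →
                    + count P (concatMap F xs) ≡ ∑[ x ← xs ] + count P (F x)
  count-concatMap P F []       = refl
  count-concatMap P F (x ∷ xs) = begin
    + count P (F x ++ concatMap F xs)             ≡⟨ cong +_ (count-++ P (F x) _) ⟩
    + (count P (F x) ℕ.+ count P (concatMap F xs)) ≡⟨ ℤ.pos-+ (count P (F x)) _ ⟩
    + count P (F x) + + count P (concatMap F xs)   ≡⟨ cong (_+_ (+ count P (F x))) (count-concatMap P F xs) ⟩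
    + count P (F x) + (∑[ x ← xs ] + count P (F x))  ∎

module FirstStep (m : Model) (P : Point → List Point → Bool) (admissible : Point → Point → Bool)
                 (P-∷ : ∀ p s w → P p (s ∷ w) ≡ admissible p s ∧ P (p +P s) w) where

  count-words-suc : ∀ n p → + count (P p) (words m (suc n))
                  ≡ ∑[ s ← steps m ] (if admissible p s then + count (P (p +P s)) (words m n) else 0ℤ)
  count-words-suc n p = trans (count-concatMap (P p) (λ s → map (s ∷_) (words m n)) (steps m))
    (∑-cong (steps m) λ {s} _ → begin
      + count (P p) (map (s ∷_) (words m n))
        ≡⟨ cong +_ (count-map (P p) (s ∷_) (words m n)) ⟩
      + count (λ w → P p (s ∷ w)) (words m n)
        ≡⟨ cong +_ (count-cong (words m n) (P-∷ p s)) ⟩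
      + count (λ w → admissible p s ∧ P (p +P s) w) (words m n)
        ≡⟨ cong +_ (count-∧ˡ (admissible p s) (P (p +P s)) (words m n)) ⟩
      + (if admissible p s then count (P (p +P s)) (words m n) else 0)
        ≡⟨ +-if (admissible p s) _ ⟩
      (if admissible p s then + count (P (p +P s)) (words m n) else 0ℤ) ∎)

walkInC walkInQ : Point → Point → List Point → Bool
walkInC q p w = confinedC p w ∧ (endpoint p w ==P q)
walkInQ q p w = confinedQ p w ∧ (endpoint p w ==P q)

walkInC-∷ : ∀ q p s w → walkInC q p (s ∷ w) ≡ (inC? p ∧ not (forbidden p (p +P s))) ∧ walkInC q (p +P s) w
walkInC-∷ q p s w with inC? p | not (forbidden p (p +P s))
... | true  | true  = refl
... | true  | false = cong (_∧ (endpoint (p +P s) w ==P q)) (∧-zeroʳ (all inC? (vertices (p +P s) w)))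
... | false | _     = refl

walkInQ-∷ : ∀ q p s w → walkInQ q p (s ∷ w) ≡ inQ? p ∧ walkInQ q (p +P s) w
walkInQ-∷ q p s w with inQ? p
... | true  = refl
... | false = refl

Ccoeff-suc : ∀ m n p q → + Ccoeff m (suc n) p q
           ≡ ∑[ s ← steps m ] (if inC? p ∧ not (forbidden p (p +P s)) then + Ccoeff m n (p +P s) q else 0ℤ)
Ccoeff-suc m n p q = FirstStep.count-words-suc m (walkInC q) (λ p s → inC? p ∧ not (forbidden p (p +P s))) (walkInC-∷ q) n p

Qcoeff-suc : ∀ m n p q → + Qcoeff m (suc n) p q
           ≡ ∑[ s ← steps m ] (if inQ? p then + Qcoeff m n (p +P s) q else 0ℤ)
Qcoeff-suc m n p q = FirstStep.count-words-suc m (walkInQ q) (λ p _ → inQ? p) (walkInQ-∷ q) n p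

Ccoeff-zero : ∀ m p q → + Ccoeff m 0 p q ≡ indicator (inC? p ∧ (p ==P q))
Ccoeff-zero m p q with inC? p | p ==P q
... | true  | true  = refl
... | true  | false = refl
... | false | _     = refl

Qcoeff-zero : ∀ m p q → + Qcoeff m 0 p q ≡ indicator (inQ? p ∧ (p ==P q))
Qcoeff-zero m p q with inQ? p | p ==P q
... | true  | true  = refl
... | true  | false = refl
... | false | _     = refl

Ccoeff-outside : ∀ m n p q → inC? p ≡ false → + Ccoeff m n p q ≡ 0ℤ
Ccoeff-outside m n p q p∉C = cong +_ (count-none _ (words m n) starts-outside)
  where
  starts-outside : ∀ w → walkInC q p w ≡ false
  starts-outside []      rewrite p∉C = refl
  starts-outside (_ ∷ _) rewrite p∉C = refl

Qcoeff-outside : ∀ m n p q → inQ? p ≡ false → + Qcoeff m n p q ≡ 0ℤ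
Qcoeff-outside m n p q p∉Q = cong +_ (count-none _ (words m n) starts-outside)
  where
  starts-outside : ∀ w → walkInQ q p w ≡ false
  starts-outside []      rewrite p∉Q = refl
  starts-outside (_ ∷ _) rewrite p∉Q = refl

all-sound : {A : Set} (f : A → Bool) {xs : List A} → T (all f xs) → ∀ {x} → x ∈ xs → T (f x)
all-sound f {x ∷ xs} fxs (here refl)  = proj₁ (Equivalence.to T-∧ fxs)
all-sound f {x ∷ xs} fxs (there x∈xs) = all-sound f (proj₂ (Equivalence.to T-∧ fxs)) x∈xs

any-sound : {A : Set} (f : A → Bool) (xs : List A) → T (any f xs) → ∃ λ x → x ∈ xs × T (f x)
any-sound f (x ∷ xs) fxs with Equivalence.to T-∨ fxs
... | inj₁ fx = x , here refl , fx
... | inj₂ fxs′ with any-sound f xs fxs′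
... | y , y∈xs , fy = y , there y∈xs , fy

-- A pair ((p , q) , (r , s)) is read as the integer matrix with columns (p , q) and (r , s); then
-- dotPair M y = M (y + (1,1)) - (1,1), an affine map whose linear part is M.
linear : MonoPair → Point → Point
linear ((p , q) , (r , s)) (a , b) = (p * a + r * b , q * a + s * b)

infixl 7 _∙_
_∙_ : MonoPair → MonoPair → MonoPair
A ∙ (u , v) = (linear A u , linear A v)

-- det M · adj M, which is M⁻¹ when det M = ±1.
unimodularInverse : MonoPair → MonoPair
unimodularInverse ((p , q) , (r , s)) = ((det * s , det * (- q)) , (det * (- r) , det * p))
  where
  det : ℤ
  det = p * s - q * r

infix 4 _≟M_ _≟P_ _≟G_ _≟E_
_≟M_ : DecidableEquality MonoPair
_≟M_ = ≡-dec (≡-dec ℤ._≟_ ℤ._≟_) (≡-dec ℤ._≟_ ℤ._≟_)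

dotPair-∙ : ∀ A B y → dotPair (A ∙ B) y ≡ dotPair A (dotPair B y)
dotPair-∙ ((p , q) , (r , s)) ((p′ , q′) , (r′ , s′)) (a , b) =
  cong₂ _,_ (row p r p′ q′ r′ s′ a b) (row q s p′ q′ r′ s′ a b)
  where
  row : ∀ p r p′ q′ r′ s′ a b →
        (p * p′ + r * q′) * (a + 1ℤ) + (p * r′ + r * s′) * (b + 1ℤ) - 1ℤ
      ≡ p * ((p′ * (a + 1ℤ) + r′ * (b + 1ℤ) - 1ℤ) + 1ℤ) + r * ((q′ * (a + 1ℤ) + s′ * (b + 1ℤ) - 1ℤ) + 1ℤ) - 1ℤ
  row = solve-∀

dotPair-idPair : ∀ y → dotPair idPair y ≡ y
dotPair-idPair (a , b) = cong₂ _,_ (first a b) (second a b)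
  where
  first : ∀ a b → + 1 * (a + 1ℤ) + 0ℤ * (b + 1ℤ) - 1ℤ ≡ a
  first = solve-∀
  second : ∀ a b → 0ℤ * (a + 1ℤ) + + 1 * (b + 1ℤ) - 1ℤ ≡ b
  second = solve-∀

dotPair-inverse : ∀ A B y → A ∙ B ≡ idPair → dotPair A (dotPair B y) ≡ y
dotPair-inverse A B y AB≡id = trans (sym (dotPair-∙ A B y)) (trans (cong (λ M → dotPair M y) AB≡id) (dotPair-idPair y))

dotPair-+P : ∀ M y v → dotPair M (y +P v) ≡ dotPair M y +P linear M v
dotPair-+P ((p , q) , (r , s)) (a , b) (v , w) = cong₂ _,_ (row p r a b v w) (row q s a b v w)
  where
  row : ∀ p r a b v w → p * ((a + v) + 1ℤ) + r * ((b + w) + 1ℤ) - 1ℤ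
                      ≡ (p * (a + 1ℤ) + r * (b + 1ℤ) - 1ℤ) + (p * v + r * w)
  row = solve-∀

-- Formal integer combinations of elements of a set with decidable equality

module FormalSum {X : Set} (_≟_ : DecidableEquality X) where

  Term : Set
  Term = ℤ × X

  coeff : X → List Term → ℤ
  coeff y L = ∑[ t ← L ] (if ⌊ proj₂ t ≟ y ⌋ then proj₁ t else 0ℤ)

  evaluate : (X → ℤ) → List Term → ℤ
  evaluate F L = ∑[ t ← L ] proj₁ t * F (proj₂ t)

  Vanishes : List Term → Set
  Vanishes L = ∀ {t} → t ∈ L → coeff (proj₂ t) L ≡ 0ℤ

  vanishes? : List Term → Bool
  vanishes? L = all (λ t → ⌊ coeff (proj₂ t) L ℤ.≟ 0ℤ ⌋) L

  without : X → List Term → List Term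
  without y = filter (λ t → ¬? (proj₂ t ≟ y))

  evaluate-without : ∀ F y L → evaluate F L ≡ coeff y L * F y + evaluate F (without y L)
  evaluate-without F y []            = refl
  evaluate-without F y ((c , x) ∷ L) with x ≟ y
  ... | yes refl = trans (cong (_+_ (c * F x)) (evaluate-without F x L)) (collect c (coeff x L) (F x) _)
    where
    collect : ∀ c b f e → c * f + (b * f + e) ≡ (c + b) * f + e
    collect = solve-∀
  ... | no _     = trans (cong (_+_ (c * F x)) (evaluate-without F y L)) (reorder (c * F x) (coeff y L) (F y) _)
    where
    reorder : ∀ a b f e → a + (b * f + e) ≡ (0ℤ + b) * f + (a + e)
    reorder = solve-∀

  coeff-without : ∀ {y z} L → y ≢ z → coeff z (without y L) ≡ coeff z L
  coeff-without []            y≢z = refl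
  coeff-without {y} {z} ((c , x) ∷ L) y≢z with x ≟ y
  ... | no _     = cong (_+_ (if ⌊ x ≟ z ⌋ then c else 0ℤ)) (coeff-without L y≢z)
  ... | yes refl with x ≟ z
  ...   | yes x≡z = ⊥-elim (y≢z x≡z)
  ...   | no _    = trans (coeff-without L y≢z) (sym (ℤ.+-identityˡ _))

  length-without-head : ∀ c x L → length (without x ((c , x) ∷ L)) ℕ.≤ length L
  length-without-head c x L with x ≟ x
  ... | yes _   = length-filter _ L
  ... | no x≢x = ⊥-elim (x≢x refl)

  Vanishes-without : ∀ y L → Vanishes L → Vanishes (without y L)
  Vanishes-without y L van {t} t∈ =
    let t∈L , x≢y = ∈-filter⁻ (λ t → ¬? (proj₂ t ≟ y)) {xs = L} t∈
    in trans (coeff-without L (≢-sym x≢y)) (van t∈L)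

  -- Removing all terms at one point keeps a combination vanishing, so recurse on the length.
  evaluate-Vanishes : ∀ F L → Vanishes L → evaluate F L ≡ 0ℤ
  evaluate-Vanishes F L = go (length L) L ℕ.≤-refl
    where
    go : ∀ n L → length L ℕ.≤ n → Vanishes L → evaluate F L ≡ 0ℤ
    go _       []            _          _   = refl
    go (suc n) ((c , x) ∷ L) (s≤s |L|≤n) van = begin
      evaluate F ((c , x) ∷ L)
        ≡⟨ evaluate-without F x ((c , x) ∷ L) ⟩
      coeff x ((c , x) ∷ L) * F x + evaluate F (without x ((c , x) ∷ L))
        ≡⟨ cong₂ (λ a e → a * F x + e) (van (here refl))
                 (go n _ (ℕ.≤-trans (length-without-head c x L) |L|≤n) (Vanishes-without x _ van)) ⟩
      0ℤ ∎

  vanishes?-sound : ∀ L → T (vanishes? L) → Vanishes L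
  vanishes?-sound L ok t∈L = toWitness (all-sound _ ok t∈L)

  negate : List Term → List Term
  negate = map λ t → (- proj₁ t , proj₂ t)

  evaluate-negate : ∀ F L → evaluate F (negate L) ≡ - evaluate F L
  evaluate-negate F []            = refl
  evaluate-negate F ((c , x) ∷ L) =
    trans (cong₂ _+_ (sym (ℤ.neg-distribˡ-* c (F x))) (evaluate-negate F L)) (sym (ℤ.neg-distrib-+ (c * F x) _))

  sameSum? : List Term → List Term → Bool
  sameSum? L L′ = vanishes? (L ++ negate L′)

  evaluate-sameSum : ∀ F L L′ → T (sameSum? L L′) → evaluate F L ≡ evaluate F L′
  evaluate-sameSum F L L′ ok = begin
    evaluate F L                                        ≡⟨ sym (ℤ.+-identityʳ _) ⟩
    evaluate F L + 0ℤ                                   ≡⟨ cong (_+_ (evaluate F L)) (sym (ℤ.+-inverseʳ (evaluate F L′))) ⟩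
    evaluate F L + (evaluate F L′ - evaluate F L′)      ≡⟨ rearrange (evaluate F L) (evaluate F L′) ⟩
    (evaluate F L + - evaluate F L′) + evaluate F L′
      ≡⟨ cong (λ e → evaluate F L + e + evaluate F L′) (sym (evaluate-negate F L′)) ⟩
    (evaluate F L + evaluate F (negate L′)) + evaluate F L′
      ≡⟨ cong (_+ evaluate F L′) (sym (∑-++ L (negate L′) (λ t → proj₁ t * F (proj₂ t)))) ⟩
    evaluate F (L ++ negate L′) + evaluate F L′
      ≡⟨ cong (_+ evaluate F L′) (evaluate-Vanishes F (L ++ negate L′) (vanishes?-sound (L ++ negate L′) ok)) ⟩
    0ℤ + evaluate F L′                                  ≡⟨ ℤ.+-identityˡ _ ⟩
    evaluate F L′                                       ∎
    where
    rearrange : ∀ a b → a + (b - b) ≡ (a + - b) + b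
    rearrange = solve-∀

  signed : {A : Set} → (A → ℤ) → (A → X) → List A → List Term
  signed c f = map λ a → (c a , f a)

  evaluate-signed : {A : Set} (F : X → ℤ) (c : A → ℤ) (f : A → X) (xs : List A) →
                    evaluate F (signed c f xs) ≡ ∑[ a ← xs ] c a * F (f a)
  evaluate-signed F c f xs = ∑-map (λ a → (c a , f a)) xs (λ t → proj₁ t * F (proj₂ t))

  ∑-reindex : {A B : Set} (F : X → ℤ) (c : A → ℤ) (f : A → X) (xs : List A) (d : B → ℤ) (g : B → X) (ys : List B) →
              T (sameSum? (signed c f xs) (signed d g ys)) →
              ∑[ a ← xs ] c a * F (f a) ≡ ∑[ b ← ys ] d b * F (g b)
  ∑-reindex F c f xs d g ys ok =
    trans (sym (evaluate-signed F c f xs))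
          (trans (evaluate-sameSum F (signed c f xs) (signed d g ys) ok) (evaluate-signed F d g ys))

-- Refuting linear inequalities in two unknowns by Fourier–Motzkin elimination

-- (c , a , b) stands for the inequality c + a x + b y ≥ 0.
Affine : Set
Affine = ℤ × ℤ × ℤ

_at_ : Affine → Point → ℤ
(c , a , b) at (x , y) = c + a * x + b * y

_⊨_ : Point → Affine → Set
p ⊨ L = 0ℤ ℤ.≤ L at p

combine : ℕ → Affine → ℕ → Affine → Affine
combine k (c , a , b) l (c′ , a′ , b′) = (+ k * c + + l * c′ , + k * a + + l * a′ , + k * b + + l * b′)

⊨-combine : ∀ {p} k {L} l {L′} → p ⊨ L → p ⊨ L′ → p ⊨ combine k L l L′
⊨-combine {x , y} k {c , a , b} l {c′ , a′ , b′} 0≤L 0≤L′ =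
  subst (0ℤ ℤ.≤_) (sym (combine-at (+ k) (+ l) c a b c′ a′ b′ x y))
        (ℤ.+-mono-≤ (scale k 0≤L) (scale l 0≤L′))
  where
  combine-at : ∀ K M c a b c′ a′ b′ x y →
    (K * c + M * c′) + (K * a + M * a′) * x + (K * b + M * b′) * y ≡ K * (c + a * x + b * y) + M * (c′ + a′ * x + b′ * y)
  combine-at = solve-∀
  scale : ∀ k {u} → 0ℤ ℤ.≤ u → 0ℤ ℤ.≤ + k * u
  scale k 0≤u = subst (ℤ._≤ + k * _) (ℤ.*-zeroʳ (+ k)) (ℤ.*-monoˡ-≤-nonNeg (+ k) 0≤u)

coefX coefY : Affine → ℤ
coefX (c , a , b) = a
coefY (c , a , b) = b

resolvents : (Affine → ℤ) → Affine → Affine → List Affine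
resolvents coef P N =
  if ⌊ 0ℤ ℤ.<? coef P ⌋ ∧ ⌊ coef N ℤ.<? 0ℤ ⌋ then combine ℤ.∣ coef N ∣ P ℤ.∣ coef P ∣ N ∷ [] else []

eliminate : (Affine → ℤ) → List Affine → List Affine
eliminate coef Ls = Ls ++ concatMap (λ P → concatMap (resolvents coef P) Ls) Ls

contradictory : Affine → Bool
contradictory (c , a , b) = (a ==ℤ 0ℤ) ∧ (b ==ℤ 0ℤ) ∧ ⌊ c ℤ.<? 0ℤ ⌋

infeasible : List Affine → Bool
infeasible Ls = any contradictory (eliminate coefY (eliminate coefX Ls))

⊨-resolvents : ∀ {p} coef {P N} → p ⊨ P → p ⊨ N → All (p ⊨_) (resolvents coef P N)
⊨-resolvents coef {P} {N} ⊨P ⊨N with ⌊ 0ℤ ℤ.<? coef P ⌋ ∧ ⌊ coef N ℤ.<? 0ℤ ⌋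
... | true  = ⊨-combine ℤ.∣ coef N ∣ ℤ.∣ coef P ∣ ⊨P ⊨N ∷ []
... | false = []

⊨-eliminate : ∀ {p} coef {Ls} → All (p ⊨_) Ls → All (p ⊨_) (eliminate coef Ls)
⊨-eliminate coef ⊨Ls = All.++⁺ ⊨Ls (All.concat⁺ (All.map⁺ (All.map (λ ⊨P →
  All.concat⁺ (All.map⁺ (All.map (⊨-resolvents coef ⊨P) ⊨Ls))) ⊨Ls)))

contradictory-sound : ∀ {p} L → T (contradictory L) → ¬ p ⊨ L
contradictory-sound {x , y} (c , a , b) contra 0≤L
  with Equivalence.to T-∧ contra
... | a≟0 , rest with Equivalence.to T-∧ rest
... | b≟0 , c<0 with toWitness {a? = a ℤ.≟ 0ℤ} a≟0 | toWitness {a? = b ℤ.≟ 0ℤ} b≟0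
... | refl | refl = ℤ.<⇒≱ (toWitness {a? = c ℤ.<? 0ℤ} c<0) (subst (0ℤ ℤ.≤_) (constant c x y) 0≤L)
  where
  constant : ∀ c x y → c + 0ℤ * x + 0ℤ * y ≡ c
  constant = solve-∀

infeasible-sound : ∀ {p} Ls → T (infeasible Ls) → ¬ All (p ⊨_) Ls
infeasible-sound Ls inf ⊨Ls with any-sound contradictory _ inf
... | L , L∈ , contra = contradictory-sound L contra (All.lookup (⊨-eliminate coefY (⊨-eliminate coefX ⊨Ls)) L∈)

_≟P_ : DecidableEquality Point
_≟P_ = ≡-dec ℤ._≟_ ℤ._≟_

==P-sound : ∀ {x y} → T (x ==P y) → x ≡ y
==P-sound {a , b} {c , d} x=y with Equivalence.to T-∧ x=y
... | a=c , b=d = cong₂ _,_ (toWitness {a? = a ℤ.≟ c} a=c) (toWitness {a? = b ℤ.≟ d} b=d)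

==P-complete : ∀ {x y} → x ≡ y → T (x ==P y)
==P-complete {a , b} refl = Equivalence.from T-∧ (fromWitness {a? = a ℤ.≟ a} refl , fromWitness {a? = b ℤ.≟ b} refl)

==P-≡ : ∀ {x y} → (x ==P y) ≡ true ⇔ x ≡ y
==P-≡ = mk⇔ (==P-sound ∘ Equivalence.from T-≡) (Equivalence.to T-≡ ∘ ==P-complete)

+P-identityʳ : ∀ p → p +P (0ℤ , 0ℤ) ≡ p
+P-identityʳ (a , b) = cong₂ _,_ (ℤ.+-identityʳ a) (ℤ.+-identityʳ b)

==P-target : ∀ y q → inQ? q ≡ true → (inQ? y ∧ (y ==P q)) ≡ (y ==P q)
==P-target y q q∈Q with y ==P q in y=q
... | false = ∧-zeroʳ (inQ? y)
... | true  = trans (cong (λ z → inQ? z ∧ true) (Equivalence.to (==P-≡ {y} {q}) y=q)) (cong (_∧ true) q∈Q)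

forbidden-target : ∀ p y → forbidden p y ≡ true → y ≡ (0ℤ , -1ℤ) ⊎ y ≡ (-1ℤ , 0ℤ)
forbidden-target p y forb
  with Equivalence.to (T-∨ {(p ==P (-1ℤ , 0ℤ)) ∧ (y ==P (0ℤ , -1ℤ))} {(p ==P (0ℤ , -1ℤ)) ∧ (y ==P (-1ℤ , 0ℤ))})
                      (Equivalence.from T-≡ forb)
... | inj₁ first  = inj₁ (==P-sound (proj₂ (Equivalence.to (T-∧ {p ==P (-1ℤ , 0ℤ)} {y ==P (0ℤ , -1ℤ)}) first)))
... | inj₂ second = inj₂ (==P-sound (proj₂ (Equivalence.to (T-∧ {p ==P (0ℤ , -1ℤ)} {y ==P (-1ℤ , 0ℤ)}) second)))

_≟G_ : DecidableEquality Gen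
φ ≟G φ = yes refl
ψ ≟G ψ = yes refl
φ ≟G ψ = no λ ()
ψ ≟G φ = no λ ()

_≟E_ : DecidableEquality Elem
e       ≟E e       = yes refl
e       ≟E alt _ _ = no λ ()
alt _ _ ≟E e       = no λ ()
alt s k ≟E alt t l with s ≟G t | k ℕ.≟ l
... | yes refl | yes refl = yes refl
... | no s≢t   | _        = no λ { refl → s≢t refl }
... | _        | no k≢l   = no λ { refl → k≢l refl }

quadrantPreimage : MonoPair → List Affine
quadrantPreimage ((p , q) , (r , s)) = (p + r - 1ℤ , p , r) ∷ (q + s - 1ℤ , q , s) ∷ []

translate : Point → Affine → Affine
translate (v , w) (c , a , b) = (c + a * v + b * w , a , b)

complementOfC : List Affine
complementOfC = (-1ℤ , -1ℤ , 0ℤ) ∷ (-1ℤ , 0ℤ , -1ℤ) ∷ []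

rightHalf upperHalf : Affine
rightHalf = (0ℤ , 1ℤ , 0ℤ)
upperHalf = (0ℤ , 0ℤ , 1ℤ)

inQ?-dotPair : ∀ M y → inQ? (dotPair M y) ≡ true → All (y ⊨_) (quadrantPreimage M)
inQ?-dotPair ((p , q) , (r , s)) (a , b) inQ
  with Equivalence.to T-∧ (Equivalence.from T-≡ inQ)
... | 0≤x , 0≤y = row p r (toWitness {a? = 0ℤ ℤ.≤? _} 0≤x) ∷ row q s (toWitness {a? = 0ℤ ℤ.≤? _} 0≤y) ∷ []
  where
  affine : ∀ p r a b → p * (a + 1ℤ) + r * (b + 1ℤ) - 1ℤ ≡ (p + r - 1ℤ) + p * a + r * b
  affine = solve-∀
  row : ∀ p r → 0ℤ ℤ.≤ p * (a + 1ℤ) + r * (b + 1ℤ) - 1ℤ → (a , b) ⊨ (p + r - 1ℤ , p , r)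
  row p r = subst (0ℤ ℤ.≤_) (affine p r a b)

inC?-false : ∀ y → inC? y ≡ false → All (y ⊨_) complementOfC
inC?-false (-[1+ a ] , -[1+ b ]) _ = ℤ.+≤+ z≤n ∷ ℤ.+≤+ z≤n ∷ []
inC?-false (+ a , y) ()
inC?-false (-[1+ a ] , + b) ()

inC?-true : ∀ y → inC? y ≡ true → y ⊨ rightHalf ⊎ y ⊨ upperHalf
inC?-true (+ a , b)         _ = inj₁ (subst (0ℤ ℤ.≤_) (sym (onlyX (+ a) b)) (ℤ.+≤+ z≤n))
  where
  onlyX : ∀ x y → 0ℤ + 1ℤ * x + 0ℤ * y ≡ x
  onlyX = solve-∀
inC?-true (-[1+ a ] , + b)  _ = inj₂ (subst (0ℤ ℤ.≤_) (sym (onlyY -[1+ a ] (+ b))) (ℤ.+≤+ z≤n))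
  where
  onlyY : ∀ x y → 0ℤ + 0ℤ * x + 1ℤ * y ≡ y
  onlyY = solve-∀
inC?-true (-[1+ a ] , -[1+ b ]) ()

InC⇒inC? : ∀ y → InC y → inC? y ≡ true
InC⇒inC? (a , b) (inj₁ 0≤a) = Equivalence.to T-≡ (Equivalence.from T-∨ (inj₁ (fromWitness {a? = 0ℤ ℤ.≤? a} 0≤a)))
InC⇒inC? (a , b) (inj₂ 0≤b) =
  Equivalence.to T-≡ (Equivalence.from (T-∨ {0ℤ ≤ℤ a}) (inj₂ (fromWitness {a? = 0ℤ ℤ.≤? b} 0≤b)))

InQ⇒inQ? : ∀ y → InQ y → inQ? y ≡ true
InQ⇒inQ? (a , b) (0≤a , 0≤b) =
  Equivalence.to T-≡ (Equivalence.from T-∧ (fromWitness {a? = 0ℤ ℤ.≤? a} 0≤a , fromWitness {a? = 0ℤ ℤ.≤? b} 0≤b))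

⊨-translate : ∀ y v L → (y +P v) ⊨ L → y ⊨ translate v L
⊨-translate (x , y) (v , w) (c , a , b) = subst (0ℤ ℤ.≤_) (shift c a b x y v w)
  where
  shift : ∀ c a b x y v w → c + a * (x + v) + b * (y + w) ≡ (c + a * v + b * w) + a * x + b * y
  shift = solve-∀

⊨-translated : ∀ y v Ls → All ((y +P v) ⊨_) Ls → All (y ⊨_) (map (translate v) Ls)
⊨-translated y v Ls ⊨Ls = All.map⁺ (All.map (λ {L} → ⊨-translate y v L) ⊨Ls)

Φ Ψ : Model → MonoPair
Φ m = value m (alt φ 1)
Ψ m = value m (alt ψ 1)

module MatrixSum = FormalSum _≟M_
module PointSum  = FormalSum _≟P_

smallStep : Point → Bool
smallStep s = (proj₁ s ≤ℤ 1ℤ) ∧ (proj₂ s ≤ℤ 1ℤ)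

module _ (m : Model) where

  preimageInC : Elem → Bool
  preimageInC g = infeasible (quadrantPreimage (value m g) ++ complementOfC)

  cornersOutsidePreimage : Elem → Bool
  cornersOutsidePreimage g = not (inQ? (dot m g (0ℤ , -1ℤ))) ∧ not (inQ? (dot m g (-1ℤ , 0ℤ)))

  shiftedωPreimage : Point → List Affine
  shiftedωPreimage s = map (translate s) (quadrantPreimage (value m (ω m)))

  ωPreimageOutsideC : Point → Bool
  ωPreimageOutsideC s = infeasible (rightHalf ∷ shiftedωPreimage s) ∧ infeasible (upperHalf ∷ shiftedωPreimage s)

  equalOrDisjointPreimages : Elem → Elem → Bool
  equalOrDisjointPreimages g h =
    ⌊ g ≟E h ⌋ ∨ infeasible (quadrantPreimage (value m g) ++ quadrantPreimage (value m h))

  leftInverseInG : Elem → Bool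
  leftInverseInG g = any (λ h → ⌊ value m h ∙ value m g ≟M idPair ⌋) (G m)

  unimodularInverseInverts : Elem → Bool
  unimodularInverseInverts g = ⌊ unimodularInverse (value m g) ∙ value m g ≟M idPair ⌋
                             ∧ ⌊ value m g ∙ unimodularInverse (value m g) ≟M idPair ⌋

  permutesSteps : Elem → Bool
  permutesSteps g = PointSum.sameSum? (PointSum.signed (λ _ → 1ℤ) (linear (value m g)) (steps m))
                                      (PointSum.signed (λ _ → 1ℤ) (λ s → s) (steps m))

  reversesSigns : MonoPair → Bool
  reversesSigns K = MatrixSum.sameSum? (MatrixSum.signed ε (λ g → K ∙ value m g) (G m))
                                       (MatrixSum.signed (-_ ∘ ε) (value m) (G m))

record WeylFacts (m : Model) : Set where
  field
    stepsSmall                : T (all smallStep (steps m))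
    quadrantPreimagesInC      : T (all (preimageInC m) (GminusΩ m))
    cornersOutsidePreimages   : T (all (cornersOutsidePreimage m) (GminusΩ m))
    ωPreimageAvoidsC          : T (all (ωPreimageOutsideC m) ((0ℤ , 0ℤ) ∷ steps m))
    quadrantPreimagesDisjoint : T (all (λ g → all (equalOrDisjointPreimages m g) (G m)) (G m))
    inversesInG               : T (all (leftInverseInG m) (G m))
    G-unique                  : T ⌊ unique? _≟E_ (G m) ⌋
    unimodularInversesInvert  : T (all (unimodularInverseInverts m) (GminusΩ m))
    inversionKeepsSigns       : T (MatrixSum.sameSum? (MatrixSum.signed ε (unimodularInverse ∘ value m) (GminusΩ m))
                                                      (MatrixSum.signed ε (value m) (GminusΩ m)))
    φReversesSigns            : T (reversesSigns m (Φ m))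
    ψReversesSigns            : T (reversesSigns m (Ψ m))
    linearPartsPermuteSteps   : T (all (permutesSteps m) (G m))

-- Every field evaluates to T true = ⊤, so each record is found by η-expansion.
weylFacts : ∀ m → WeylFacts m
weylFacts simple           = _
weylFacts diagonal         = _
weylFacts king             = _
weylFacts diabolo          = _
weylFacts tandem           = _
weylFacts doubleTandem     = _
weylFacts gouyouBeauchamps = _

true≢false : true ≢ false
true≢false ()

module Geometry (m : Model) where
  open WeylFacts (weylFacts m)

  ∈G-split : ∀ {g} → g ∈ G m → g ∈ GminusΩ m ⊎ g ≡ ω m
  ∈G-split g∈G with ∈-++⁻ (GminusΩ m) g∈G
  ... | inj₁ g∈G′         = inj₁ g∈G′
  ... | inj₂ (here g≡ω)  = inj₂ g≡ω

  step-≤1 : ∀ {s} → s ∈ steps m → proj₁ s ℤ.≤ 1ℤ × proj₂ s ℤ.≤ 1ℤ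
  step-≤1 {s} s∈S with Equivalence.to (T-∧ {proj₁ s ≤ℤ 1ℤ}) (all-sound smallStep stepsSmall s∈S)
  ... | x≤1 , y≤1 = toWitness {a? = proj₁ s ℤ.≤? 1ℤ} x≤1 , toWitness {a? = proj₂ s ℤ.≤? 1ℤ} y≤1

  preimage-⊆-C : ∀ {g y} → g ∈ GminusΩ m → inQ? (dot m g y) ≡ true → inC? y ≡ true
  preimage-⊆-C {g} {y} g∈G′ inQ with inC? y in y∉C
  ... | true  = refl
  ... | false = ⊥-elim (infeasible-sound _ (all-sound (preimageInC m) quadrantPreimagesInC g∈G′)
                          (All.++⁺ (inQ?-dotPair (value m g) y inQ) (inC?-false y y∉C)))

  preimage-avoids-corners : ∀ {g y} → g ∈ GminusΩ m → inQ? (dot m g y) ≡ true → ∀ p → forbidden p y ≡ false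
  preimage-avoids-corners {g} {y} g∈G′ inQ p with forbidden p y in forb
  ... | false = refl
  ... | true
    with forbidden-target p y forb
       | Equivalence.to (T-∧ {not (inQ? (dot m g (0ℤ , -1ℤ)))} {not (inQ? (dot m g (-1ℤ , 0ℤ)))})
                        (all-sound (cornersOutsidePreimage m) cornersOutsidePreimages g∈G′)
  ... | inj₁ refl | lower∉ , _ =
    ⊥-elim (true≢false (trans (sym inQ) (Equivalence.to (T-not-≡ {inQ? (dot m g (0ℤ , -1ℤ))}) lower∉)))
  ... | inj₂ refl | _ , left∉ =
    ⊥-elim (true≢false (trans (sym inQ) (Equivalence.to (T-not-≡ {inQ? (dot m g (-1ℤ , 0ℤ))}) left∉)))

  ω-preimage-avoids-C : ∀ p s → inC? p ≡ true → s ∈ (0ℤ , 0ℤ) ∷ steps m → inQ? (dot m (ω m) (p +P s)) ≡ true → ⊥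
  ω-preimage-avoids-C p s p∈C s∈ inQ = refute (inC?-true p p∈C)
    where
    translated : All (p ⊨_) (shiftedωPreimage m s)
    translated = ⊨-translated p s _ (inQ?-dotPair (value m (ω m)) (p +P s) inQ)
    infeasibilities : T (infeasible (rightHalf ∷ shiftedωPreimage m s)) × T (infeasible (upperHalf ∷ shiftedωPreimage m s))
    infeasibilities = Equivalence.to T-∧ (all-sound (ωPreimageOutsideC m) ωPreimageAvoidsC s∈)
    refute : p ⊨ rightHalf ⊎ p ⊨ upperHalf → ⊥
    refute (inj₁ right) = infeasible-sound (rightHalf ∷ shiftedωPreimage m s) (proj₁ infeasibilities) (right ∷ translated)
    refute (inj₂ upper) = infeasible-sound (upperHalf ∷ shiftedωPreimage m s) (proj₂ infeasibilities) (upper ∷ translated)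

  preimages-disjoint : ∀ {g h} y → g ∈ G m → h ∈ G m →
                       inQ? (dot m g y) ≡ true → inQ? (dot m h y) ≡ true → g ≡ h
  preimages-disjoint {g} {h} y g∈G h∈G inQ₁ inQ₂
    with Equivalence.to (T-∨ {⌊ g ≟E h ⌋})
           (all-sound (equalOrDisjointPreimages m g)
                      (all-sound (λ g → all (equalOrDisjointPreimages m g) (G m)) quadrantPreimagesDisjoint g∈G) h∈G)
  ... | inj₁ g≡h = toWitness {a? = g ≟E h} g≡h
  ... | inj₂ inf = ⊥-elim (infeasible-sound _ inf
                      (All.++⁺ (inQ?-dotPair (value m g) y inQ₁) (inQ?-dotPair (value m h) y inQ₂)))

  inverse-in-G : ∀ {g} → g ∈ G m → ∃ λ h → h ∈ G m × value m h ∙ value m g ≡ idPair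
  inverse-in-G {g} g∈G
    with any-sound (λ h → ⌊ value m h ∙ value m g ≟M idPair ⌋) (G m) (all-sound (leftInverseInG m) inversesInG g∈G)
  ... | h , h∈G , inv = h , h∈G , toWitness {a? = value m h ∙ value m g ≟M idPair} inv

  Outside : Point → Set
  Outside y = ∀ {g} → g ∈ G m → inQ? (dot m g y) ≡ false

  blocked-step-outside : ∀ p s → inC? p ≡ true → s ∈ steps m →
                         inC? (p +P s) ≡ false ⊎ forbidden p (p +P s) ≡ true → Outside (p +P s)
  blocked-step-outside p s p∈C s∈S blocked {g} g∈G with inQ? (dot m g (p +P s)) in inQ
  ... | false = refl
  ... | true with ∈G-split g∈G | blocked
  ...   | inj₂ refl  | _           = ⊥-elim (ω-preimage-avoids-C p s p∈C (there s∈S) inQ)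
  ...   | inj₁ g∈G′ | inj₁ outside =
    ⊥-elim (true≢false (trans (sym (preimage-⊆-C {y = p +P s} g∈G′ inQ)) outside))
  ...   | inj₁ g∈G′ | inj₂ forb    =
    ⊥-elim (true≢false (trans (sym forb) (preimage-avoids-corners {y = p +P s} g∈G′ inQ p)))

-- Cancellation of boundary terms in signed orbit sums

≤ℤ-false : ∀ {x y} → y ℤ.< x → (x ≤ℤ y) ≡ false
≤ℤ-false {x} {y} y<x with x ℤ.≤? y
... | yes x≤y = ⊥-elim (ℤ.<⇒≱ y<x x≤y)
... | no _    = refl

==ℤ-false : ∀ {x y} → x ≢ y → (x ==ℤ y) ≡ false
==ℤ-false {x} {y} x≢y with x ℤ.≟ y
... | yes x≡y = ⊥-elim (x≢y x≡y)
... | no _    = refl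

inQ?-false : ∀ a b → inQ? (a , b) ≡ false → a ℤ.< 0ℤ ⊎ b ℤ.< 0ℤ
inQ?-false a b a,b∉Q with 0ℤ ℤ.≤? a | 0ℤ ℤ.≤? b
... | no 0≰a | _       = inj₁ (ℤ.≰⇒> 0≰a)
... | yes _  | no 0≰b  = inj₂ (ℤ.≰⇒> 0≰b)
... | yes _  | yes _   = ⊥-elim (true≢false a,b∉Q)

stays-negative-after-step : ∀ {a} t → a ℤ.< 0ℤ → a ≢ -1ℤ → t ℤ.≤ 1ℤ → a + t ℤ.< 0ℤ
stays-negative-after-step { + _ }          t (ℤ.+<+ ()) _ _
stays-negative-after-step { -[1+ zero ] }  t _ a≢-1 _ = ⊥-elim (a≢-1 refl)
stays-negative-after-step { -[1+ suc k ] } t _ _ t≤1 = ℤ.≤-<-trans (ℤ.+-monoʳ-≤ -[1+ suc k ] t≤1) ℤ.-<+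

reflect-≢-1 : ∀ {a} → a ≢ -1ℤ → - a - + 2 ≢ -1ℤ
reflect-≢-1 {a} a≢-1 image≡-1 = a≢-1 (trans (sym (involutive a)) (cong (λ z → - z - + 2) image≡-1))
  where
  involutive : ∀ a → - (- a - + 2) - + 2 ≡ a
  involutive = solve-∀

module Boundary (m : Model) where
  open WeylFacts (weylFacts m)
  open Geometry m

  orbitSum : (Point → ℤ) → Point → ℤ
  orbitSum H y = ∑[ g ← G m ] ε g * H (dot m g y)

  self-negating : ∀ x → x ≡ - x → x ≡ 0ℤ
  self-negating (+ zero)   _  = refl
  self-negating (+ suc n)  ()
  self-negating -[1+ n ]   ()

  -- g ↦ K g is a sign-reversing bijection of G, so an H fixed by K̇ has a self-negating orbit sum.
  orbitSum-invariant : ∀ K → T (reversesSigns m K) → (H : Point → ℤ) →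
                       (∀ y → H (dotPair K y) ≡ H y) → ∀ y → orbitSum H y ≡ 0ℤ
  orbitSum-invariant K reverses H H∘K≡H y = self-negating (orbitSum H y) (begin
    orbitSum H y
      ≡⟨ ∑-cong (G m) (λ {g} _ → cong (ε g *_)
           (trans (sym (H∘K≡H (dot m g y))) (cong H (sym (dotPair-∙ K (value m g) y))))) ⟩
    ∑[ g ← G m ] ε g * H (dotPair (K ∙ value m g) y)
      ≡⟨ MatrixSum.∑-reindex (λ M → H (dotPair M y)) ε (λ g → K ∙ value m g) (G m) (-_ ∘ ε) (value m) (G m) reverses ⟩
    ∑[ g ← G m ] - ε g * H (dot m g y)
      ≡⟨ ∑-cong (G m) (λ {g} _ → sym (ℤ.neg-distribˡ-* (ε g) (H (dot m g y)))) ⟩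
    ∑[ g ← G m ] - (ε g * H (dot m g y))
      ≡⟨ ∑-neg (G m) (λ g → ε g * H (dot m g y)) ⟩
    - orbitSum H y ∎)

  Φ-x : ∀ a b → proj₁ (dotPair (Φ m) (a , b)) ≡ - a - + 2
  Φ-x a b = coordinate (rV m) a b
    where
    coordinate : ∀ r a b → (r * 0ℤ - + 1) * (a + 1ℤ) + 0ℤ * (b + 1ℤ) - 1ℤ ≡ - a - + 2
    coordinate = solve-∀

  Φ-fixes : ∀ b → dotPair (Φ m) (-1ℤ , b) ≡ (-1ℤ , b)
  Φ-fixes b = cong₂ _,_ (Φ-x -1ℤ b) (second (rV m) b)
    where
    second : ∀ r b → (r * + 1 - 0ℤ) * (-1ℤ + 1ℤ) + + 1 * (b + 1ℤ) - 1ℤ ≡ b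
    second = solve-∀

  Ψ-y : ∀ a b → proj₂ (dotPair (Ψ m) (a , b)) ≡ - b - + 2
  Ψ-y a b = coordinate (rH m) a b
    where
    coordinate : ∀ r a b → 0ℤ * (a + 1ℤ) + (r * 0ℤ - + 1) * (b + 1ℤ) - 1ℤ ≡ - b - + 2
    coordinate = solve-∀

  Ψ-fixes : ∀ a → dotPair (Ψ m) (a , -1ℤ) ≡ (a , -1ℤ)
  Ψ-fixes a = cong₂ _,_ (first (rH m) a) (Ψ-y a -1ℤ)
    where
    first : ∀ r a → + 1 * (a + 1ℤ) + (r * + 1 - 0ℤ) * (-1ℤ + 1ℤ) - 1ℤ ≡ a
    first = solve-∀

  stepSum : (Point → ℤ) → Point → ℤ
  stepSum f y = ∑[ s ← steps m ] f (y +P s)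

  boundary : (Point → ℤ) → Point → ℤ
  boundary f y = if inQ? y then 0ℤ else stepSum f y

  leftBoundary lowerBoundary : (Point → ℤ) → Point → ℤ
  leftBoundary  f y = if proj₁ y ==ℤ -1ℤ then boundary f y else 0ℤ
  lowerBoundary f y = if proj₂ y ==ℤ -1ℤ then (if proj₁ y ==ℤ -1ℤ then 0ℤ else boundary f y) else 0ℤ

  module _ (f : Point → ℤ) (f-outside : ∀ y → inQ? y ≡ false → f y ≡ 0ℤ) where

    -- A step of size at most one cannot reach 𝒬 from a point with a coordinate ≤ -2.
    boundary-off-lines : ∀ a b → a ≢ -1ℤ → b ≢ -1ℤ → boundary f (a , b) ≡ 0ℤ
    boundary-off-lines a b a≢-1 b≢-1 with inQ? (a , b) in a,b∉Q
    ... | true  = refl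
    ... | false = ∑-zero (steps m) λ {s} s∈S → f-outside ((a , b) +P s) (leaves s∈S (inQ?-false a b a,b∉Q))
      where
      leaves : ∀ {s} → s ∈ steps m → a ℤ.< 0ℤ ⊎ b ℤ.< 0ℤ → inQ? ((a , b) +P s) ≡ false
      leaves {s} s∈S (inj₁ a<0) =
        cong (_∧ (0ℤ ≤ℤ (b + proj₂ s)))
             (≤ℤ-false (stays-negative-after-step (proj₁ s) a<0 a≢-1 (proj₁ (step-≤1 s∈S))))
      leaves {s} s∈S (inj₂ b<0) =
        trans (cong ((0ℤ ≤ℤ (a + proj₁ s)) ∧_)
                    (≤ℤ-false (stays-negative-after-step (proj₂ s) b<0 b≢-1 (proj₂ (step-≤1 s∈S)))))
              (∧-zeroʳ _)

    boundary-split : ∀ y → boundary f y ≡ leftBoundary f y + lowerBoundary f y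
    boundary-split (a , b) with a ℤ.≟ -1ℤ | b ℤ.≟ -1ℤ
    ... | yes _    | yes _    = sym (ℤ.+-identityʳ _)
    ... | yes _    | no _     = sym (ℤ.+-identityʳ _)
    ... | no _     | yes _    = sym (ℤ.+-identityˡ _)
    ... | no a≢-1 | no b≢-1 = boundary-off-lines a b a≢-1 b≢-1

    leftBoundary-Φ : ∀ y → leftBoundary f (dotPair (Φ m) y) ≡ leftBoundary f y
    leftBoundary-Φ (a , b) with a ℤ.≟ -1ℤ
    ... | yes refl = cong (leftBoundary f) (Φ-fixes b)
    ... | no a≢-1 =
      cong (λ c → if c then boundary f (dotPair (Φ m) (a , b)) else 0ℤ)
           (trans (cong (_==ℤ -1ℤ) (Φ-x a b)) (==ℤ-false (reflect-≢-1 a≢-1)))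

    lowerBoundary-Ψ : ∀ y → lowerBoundary f (dotPair (Ψ m) y) ≡ lowerBoundary f y
    lowerBoundary-Ψ (a , b) with b ℤ.≟ -1ℤ
    ... | yes refl = cong (lowerBoundary f) (Ψ-fixes a)
    ... | no b≢-1 =
      cong (λ c → if c then (if proj₁ y′ ==ℤ -1ℤ then 0ℤ else boundary f y′) else 0ℤ)
           (trans (cong (_==ℤ -1ℤ) (Ψ-y a b)) (==ℤ-false (reflect-≢-1 b≢-1)))
      where
      y′ : Point
      y′ = dotPair (Ψ m) (a , b)

    orbitSum-boundary : ∀ y → orbitSum (boundary f) y ≡ 0ℤ
    orbitSum-boundary y = begin
      orbitSum (boundary f) y
        ≡⟨ ∑-cong (G m) (λ {g} _ → trans (cong (ε g *_) (boundary-split (dot m g y)))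
                                          (ℤ.*-distribˡ-+ (ε g) (leftBoundary f (dot m g y)) (lowerBoundary f (dot m g y)))) ⟩
      ∑[ g ← G m ] (ε g * leftBoundary f (dot m g y) + ε g * lowerBoundary f (dot m g y))
        ≡⟨ ∑-+ (G m) (λ g → ε g * leftBoundary f (dot m g y)) (λ g → ε g * lowerBoundary f (dot m g y)) ⟩
      orbitSum (leftBoundary f) y + orbitSum (lowerBoundary f) y
        ≡⟨ cong₂ _+_ (orbitSum-invariant (Φ m) φReversesSigns (leftBoundary f) leftBoundary-Φ y)
                     (orbitSum-invariant (Ψ m) ψReversesSigns (lowerBoundary f) lowerBoundary-Ψ y) ⟩
      0ℤ ∎

-- The identity  Σ_{g ≠ ω} ε_g C^p_{ġ q} = Σ_g ε_g Q^{ġ p}_q  for p ∈ 𝒞 and q ∈ 𝒬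

*-if : ∀ c (b : Bool) z → c * (if b then z else 0ℤ) ≡ (if b then c * z else 0ℤ)
*-if c true  z = refl
*-if c false z = ℤ.*-zeroʳ c

module Main (m : Model) where
  open WeylFacts (weylFacts m)
  open Geometry m
  open Boundary m

  walksQ : ℕ → Point → Point → ℤ
  walksQ n q y = + Qcoeff m n y q

  lhs rhs : ℕ → Point → Point → ℤ
  lhs n p q = ∑[ g ← GminusΩ m ] ε g * + Ccoeff m n p (dot m g q)
  rhs n p q = orbitSum (walksQ n q) p

  admissible : Point → Point → Bool
  admissible p s = not (forbidden p (p +P s))

  ∑-G : (F : Elem → ℤ) → ∑ (G m) F ≡ ∑ (GminusΩ m) F + F (ω m)
  ∑-G F = trans (∑-++ (GminusΩ m) (ω m ∷ []) F) (cong (_+_ (∑ (GminusΩ m) F)) (ℤ.+-identityʳ (F (ω m))))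

  lhs-outside : ∀ n p q → inC? p ≡ false → lhs n p q ≡ 0ℤ
  lhs-outside n p q p∉C = ∑-zero (GminusΩ m) λ {g} _ →
    trans (cong (ε g *_) (Ccoeff-outside m n p (dot m g q) p∉C)) (ℤ.*-zeroʳ (ε g))

  rhs-outside : ∀ n p q → Outside p → rhs n p q ≡ 0ℤ
  rhs-outside n p q outside = ∑-zero (G m) λ {g} g∈G →
    trans (cong (ε g *_) (Qcoeff-outside m n (dot m g p) q (outside g∈G))) (ℤ.*-zeroʳ (ε g))

  unimodularInverse-transposes : ∀ {g} → g ∈ GminusΩ m → ∀ p q →
                                 (p ==P dot m g q) ≡ (dotPair (unimodularInverse (value m g)) p ==P q)
  unimodularInverse-transposes {g} g∈G′ p q
    with Equivalence.to T-∧ (all-sound (unimodularInverseInverts m) unimodularInversesInvert g∈G′)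
  ... | left , right = ⇔→≡ (mk⇔
    (λ p=ġq → Equivalence.from (==P-≡ {dotPair A p} {q})
                (trans (cong (dotPair A) (Equivalence.to (==P-≡ {p} {dotPair M q}) p=ġq))
                       (dotPair-inverse A M q (toWitness {a? = A ∙ M ≟M idPair} left))))
    (λ Ap=q → Equivalence.from (==P-≡ {p} {dotPair M q})
                (trans (sym (dotPair-inverse M A p (toWitness {a? = M ∙ A ≟M idPair} right)))
                       (cong (dotPair M) (Equivalence.to (==P-≡ {dotPair A p} {q}) Ap=q)))))
    where
    M A : MonoPair
    M = value m g
    A = unimodularInverse M

  walksQ-zero : ∀ {q} y → inQ? q ≡ true → walksQ 0 q y ≡ indicator (y ==P q)
  walksQ-zero {q} y q∈Q = trans (Qcoeff-zero m y q) (cong indicator (==P-target y q q∈Q))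

  identity-zero : ∀ p q → inC? p ≡ true → inQ? q ≡ true → lhs 0 p q ≡ rhs 0 p q
  identity-zero p q p∈C q∈Q = begin
    lhs 0 p q
      ≡⟨ ∑-cong (GminusΩ m) (λ {g} g∈G′ → cong (ε g *_) (begin
           + Ccoeff m 0 p (dot m g q)                          ≡⟨ Ccoeff-zero m p (dot m g q) ⟩
           indicator (inC? p ∧ (p ==P dot m g q))              ≡⟨ cong (λ b → indicator (b ∧ (p ==P dot m g q))) p∈C ⟩
           indicator (p ==P dot m g q)                         ≡⟨ cong indicator (unimodularInverse-transposes g∈G′ p q) ⟩
           indicator (dotPair (unimodularInverse (value m g)) p ==P q) ∎)) ⟩
    ∑[ g ← GminusΩ m ] ε g * indicator (dotPair (unimodularInverse (value m g)) p ==P q)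
      ≡⟨ MatrixSum.∑-reindex (λ M → indicator (dotPair M p ==P q)) ε (unimodularInverse ∘ value m) (GminusΩ m)
                             ε (value m) (GminusΩ m) inversionKeepsSigns ⟩
    ∑[ g ← GminusΩ m ] ε g * indicator (dot m g p ==P q)
      ≡⟨ ∑-cong (GminusΩ m) (λ {g} _ → cong (ε g *_) (sym (walksQ-zero (dot m g p) q∈Q))) ⟩
    ∑[ g ← GminusΩ m ] ε g * walksQ 0 q (dot m g p)
      ≡⟨ sym (ℤ.+-identityʳ _) ⟩
    (∑[ g ← GminusΩ m ] ε g * walksQ 0 q (dot m g p)) + 0ℤ
      ≡⟨ cong (_+_ (∑[ g ← GminusΩ m ] ε g * walksQ 0 q (dot m g p))) (sym ω-term) ⟩
    (∑[ g ← GminusΩ m ] ε g * walksQ 0 q (dot m g p)) + ε (ω m) * walksQ 0 q (dot m (ω m) p)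
      ≡⟨ sym (∑-G (λ g → ε g * walksQ 0 q (dot m g p))) ⟩
    rhs 0 p q ∎
    where
    ω̇p∉Q : inQ? (dot m (ω m) p) ≡ false
    ω̇p∉Q with inQ? (dot m (ω m) p) in ω̇p∈Q
    ... | false = refl
    ... | true  = ⊥-elim (ω-preimage-avoids-C p (0ℤ , 0ℤ) p∈C (here refl)
                    (subst (λ y → inQ? (dot m (ω m) y) ≡ true) (sym (+P-identityʳ p)) ω̇p∈Q))
    ω-term : ε (ω m) * walksQ 0 q (dot m (ω m) p) ≡ 0ℤ
    ω-term = trans (cong (ε (ω m) *_) (Qcoeff-outside m 0 (dot m (ω m) p) q ω̇p∉Q)) (ℤ.*-zeroʳ (ε (ω m)))

  lhs-suc : ∀ n p q → inC? p ≡ true →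
            lhs (suc n) p q ≡ ∑[ s ← steps m ] (if admissible p s then lhs n (p +P s) q else 0ℤ)
  lhs-suc n p q p∈C = begin
    lhs (suc n) p q
      ≡⟨ ∑-cong (GminusΩ m) (λ {g} _ → cong (ε g *_) (trans (Ccoeff-suc m n p (dot m g q))
           (∑-cong (steps m) λ {s} _ →
              cong (λ b → if b ∧ admissible p s then + Ccoeff m n (p +P s) (dot m g q) else 0ℤ) p∈C))) ⟩
    ∑[ g ← GminusΩ m ] ε g * (∑[ s ← steps m ] C g s)
      ≡⟨ ∑-cong (GminusΩ m) (λ {g} _ → sym (∑-*ˡ (ε g) (steps m) (C g))) ⟩
    ∑[ g ← GminusΩ m ] ∑[ s ← steps m ] ε g * C g s
      ≡⟨ ∑-swap (GminusΩ m) (steps m) (λ g s → ε g * C g s) ⟩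
    ∑[ s ← steps m ] ∑[ g ← GminusΩ m ] ε g * C g s
      ≡⟨ ∑-cong (steps m) (λ {s} _ →
           trans (∑-cong (GminusΩ m) λ {g} _ → *-if (ε g) (admissible p s) (+ Ccoeff m n (p +P s) (dot m g q)))
                 (∑-if (admissible p s) (GminusΩ m) λ g → ε g * + Ccoeff m n (p +P s) (dot m g q))) ⟩
    ∑[ s ← steps m ] (if admissible p s then lhs n (p +P s) q else 0ℤ) ∎
    where
    C : Elem → Point → ℤ
    C g s = if admissible p s then + Ccoeff m n (p +P s) (dot m g q) else 0ℤ

  stepSum-dot : ∀ f {g} → g ∈ G m → ∀ y → ∑[ s ← steps m ] f (dot m g (y +P s)) ≡ stepSum f (dot m g y)
  stepSum-dot f {g} g∈G y = begin
    ∑[ s ← steps m ] f (dot m g (y +P s))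
      ≡⟨ ∑-cong (steps m) (λ {s} _ →
           trans (cong f (dotPair-+P (value m g) y s)) (sym (ℤ.*-identityˡ (F (linear (value m g) s))))) ⟩
    ∑[ s ← steps m ] 1ℤ * F (linear (value m g) s)
      ≡⟨ PointSum.∑-reindex F (λ _ → 1ℤ) (linear (value m g)) (steps m) (λ _ → 1ℤ) (λ s → s) (steps m)
                            (all-sound (permutesSteps m) linearPartsPermuteSteps g∈G) ⟩
    ∑[ s ← steps m ] 1ℤ * F s
      ≡⟨ ∑-cong (steps m) (λ {s} _ → ℤ.*-identityˡ (F s)) ⟩
    stepSum f (dot m g y) ∎
    where
    F : Point → ℤ
    F v = f (dot m g y +P v)

  stepSum-split : ∀ n q y → stepSum (walksQ n q) y ≡ walksQ (suc n) q y + boundary (walksQ n q) y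
  stepSum-split n q y = trans split (cong (_+ boundary (walksQ n q) y) (sym first-step))
    where
    first-step : walksQ (suc n) q y ≡ (if inQ? y then stepSum (walksQ n q) y else 0ℤ)
    first-step = trans (Qcoeff-suc m n y q) (∑-if (inQ? y) (steps m) λ s → walksQ n q (y +P s))
    split : stepSum (walksQ n q) y ≡ (if inQ? y then stepSum (walksQ n q) y else 0ℤ) + boundary (walksQ n q) y
    split with inQ? y
    ... | true  = sym (ℤ.+-identityʳ _)
    ... | false = sym (ℤ.+-identityˡ _)

  rhs-suc : ∀ n p q → ∑[ s ← steps m ] rhs n (p +P s) q ≡ rhs (suc n) p q
  rhs-suc n p q = begin
    ∑[ s ← steps m ] ∑[ g ← G m ] ε g * f (dot m g (p +P s))
      ≡⟨ ∑-swap (steps m) (G m) (λ s g → ε g * f (dot m g (p +P s))) ⟩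
    ∑[ g ← G m ] ∑[ s ← steps m ] ε g * f (dot m g (p +P s))
      ≡⟨ ∑-cong (G m) (λ {g} g∈G → trans (∑-*ˡ (ε g) (steps m) λ s → f (dot m g (p +P s)))
                                          (cong (ε g *_) (stepSum-dot f g∈G p))) ⟩
    ∑[ g ← G m ] ε g * stepSum f (dot m g p)
      ≡⟨ ∑-cong (G m) (λ {g} _ → trans (cong (ε g *_) (stepSum-split n q (dot m g p)))
                                        (ℤ.*-distribˡ-+ (ε g) (walksQ (suc n) q (dot m g p)) (boundary f (dot m g p)))) ⟩
    ∑[ g ← G m ] (ε g * walksQ (suc n) q (dot m g p) + ε g * boundary f (dot m g p))
      ≡⟨ ∑-+ (G m) (λ g → ε g * walksQ (suc n) q (dot m g p)) (λ g → ε g * boundary f (dot m g p)) ⟩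
    rhs (suc n) p q + orbitSum (boundary f) p
      ≡⟨ cong (_+_ (rhs (suc n) p q)) (orbitSum-boundary f (λ y y∉Q → Qcoeff-outside m n y q y∉Q) p) ⟩
    rhs (suc n) p q + 0ℤ
      ≡⟨ ℤ.+-identityʳ _ ⟩
    rhs (suc n) p q ∎
    where
    f : Point → ℤ
    f = walksQ n q

  step-term : ∀ n p q → (∀ p′ → inC? p′ ≡ true → lhs n p′ q ≡ rhs n p′ q) →
              inC? p ≡ true → ∀ {s} → s ∈ steps m →
              (if admissible p s then lhs n (p +P s) q else 0ℤ) ≡ rhs n (p +P s) q
  step-term n p q IH p∈C {s} s∈S with forbidden p (p +P s) in forb | inC? (p +P s) in p+s∈C
  ... | true  | _     = sym (rhs-outside n (p +P s) q (blocked-step-outside p s p∈C s∈S (inj₂ forb)))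
  ... | false | true  = IH (p +P s) p+s∈C
  ... | false | false = trans (lhs-outside n (p +P s) q p+s∈C)
                             (sym (rhs-outside n (p +P s) q (blocked-step-outside p s p∈C s∈S (inj₁ p+s∈C))))

  identity : ∀ n p q → inC? p ≡ true → inQ? q ≡ true → lhs n p q ≡ rhs n p q
  identity zero    p q p∈C q∈Q = identity-zero p q p∈C q∈Q
  identity (suc n) p q p∈C q∈Q = begin
    lhs (suc n) p q                                                     ≡⟨ lhs-suc n p q p∈C ⟩
    ∑[ s ← steps m ] (if admissible p s then lhs n (p +P s) q else 0ℤ)  ≡⟨ ∑-cong (steps m) (step-term n p q IH p∈C) ⟩
    ∑[ s ← steps m ] rhs n (p +P s) q                                   ≡⟨ rhs-suc n p q ⟩
    rhs (suc n) p q                                                     ∎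
    where
    IH : ∀ p′ → inC? p′ ≡ true → lhs n p′ q ≡ rhs n p′ q
    IH p′ p′∈C = identity n p′ q p′∈C q∈Q

  no-preimage-outside : ∀ p → ¬ (∃ λ g → g ∈ G m × ∃₂ λ i j → dot m g (+ i , + j) ≡ p) → Outside p
  no-preimage-outside p no-preimage {g} g∈G with inQ? (dot m g p) in ġp∈Q
  ... | false = refl
  ... | true with inverse-in-G g∈G | Equivalence.to T-∧ (Equivalence.from T-≡ ġp∈Q)
  ...   | h , h∈G , h∙g≡id | 0≤x , 0≤y = ⊥-elim (no-preimage (h , h∈G , ℤ.∣ x ∣ , ℤ.∣ y ∣ , h-maps-back))
    where
    x y : ℤ
    x = proj₁ (dot m g p)
    y = proj₂ (dot m g p)
    h-maps-back : dot m h (+ ℤ.∣ x ∣ , + ℤ.∣ y ∣) ≡ p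
    h-maps-back = trans (cong (dot m h) (cong₂ _,_ (ℤ.0≤i⇒+∣i∣≡i (toWitness {a? = 0ℤ ℤ.≤? x} 0≤x))
                                                    (ℤ.0≤i⇒+∣i∣≡i (toWitness {a? = 0ℤ ℤ.≤? y} 0≤y))))
                        (dotPair-inverse (value m h) (value m g) p h∙g≡id)

  rhs-single-preimage : ∀ n p q {h} → h ∈ G m → inQ? (dot m h p) ≡ true → rhs n p q ≡ ε h * walksQ n q (dot m h p)
  rhs-single-preimage n p q {h} h∈G ḣp∈Q =
    ∑-unique (λ g → ε g * walksQ n q (dot m g p)) (toWitness {a? = unique? _≟E_ (G m)} G-unique) h∈G vanishes
    where
    vanishes : ∀ {g} → g ∈ G m → g ≢ h → ε g * walksQ n q (dot m g p) ≡ 0ℤ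
    vanishes {g} g∈G g≢h with inQ? (dot m g p) in ġp∈Q
    ... | true  = ⊥-elim (g≢h (preimages-disjoint p g∈G h∈G ġp∈Q ḣp∈Q))
    ... | false = trans (cong (ε g *_) (Qcoeff-outside m n (dot m g p) q ġp∈Q)) (ℤ.*-zeroʳ (ε g))

proposition15 : (m : Model) (a b : ℤ) → InC (a , b) →
    ( ¬ (∃ λ g → g ∈ G m × ∃₂ λ i j → dot m g (+ i , + j) ≡ (a , b))
      → (n i j : ℕ) → sumLHS m (a , b) n i j ≡ 0ℤ )
    × ( (h : Elem) → h ∈ G m → InQ (dot m h (a , b))
      → (n i j : ℕ) → sumLHS m (a , b) n i j ≡ ε h * + Qcoeff m n (dot m h (a , b)) (+ i , + j) )
proposition15 m a b p∈C =
    (λ no-preimage n i j →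
       trans (identity n (a , b) (+ i , + j) (InC⇒inC? (a , b) p∈C) refl)
             (rhs-outside n (a , b) (+ i , + j) (no-preimage-outside (a , b) no-preimage)))
  , (λ h h∈G ḣp∈Q n i j →
       trans (identity n (a , b) (+ i , + j) (InC⇒inC? (a , b) p∈C) refl)
             (rhs-single-preimage n (a , b) (+ i , + j) h∈G (InQ⇒inQ? (dot m h (a , b)) ḣp∈Q)))
  where open Main m
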